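{- The equational theory of the class of algebras of binary relations of the signature $\{;,+,{}^*,0,1,\mathrm{D}\}$ is decidable: there is an algorithm that, given $\{;,+,{}^*,0,1,\mathrm{D}\}$-terms $s$ and $t$, decides whether $s=t$ holds in every such algebra under every assignment of its elements to the variables.
   Context: An algebra of binary relations of signature $\{;,+,{}^*,0,1,\mathrm{D}\}$ is a set of binary relations on a common base $X$ closed under composition $R;S=\{(x,y):\exists z\,(x,z)\in R,(z,y)\in S\}$, union $+$, reflexive transitive closure $R^*=\bigcup_{n\ge0}R^n$ ($R^0$ the identity), domain $\mathrm{D}(R)=\{(x,x):\exists y\,(x,y)\in R\}$, and containing $0=\emptyset$ and $1=$ the identity relation on $X$, with these operations. -}

module Defs where

open import Level using (Level)
open import Data.Nat using (ℕ; zero; suc)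
open import Data.Product using (Σ; ∃; _×_; _,_)
open import Relation.Binary.PropositionalEquality using (_≡_)

data Term : Set where
  var  : ℕ → Term
  _⨾_  : Term → Term → Term
  _⊕_  : Term → Term → Term
  _⋆   : Term → Term
  𝟘    : Term
  𝟙    : Term
  D    : Term → Term

BRel : Set → Set₁
BRel X = X → X → Set

module _ {X : Set} where
  comp : BRel X → BRel X → BRel X
  comp R S x y = ∃ λ z → R x z × S z y

  union : BRel X → BRel X → BRel X
  union R S x y = R x y ⊎' S x y
    where
    open import Data.Sum using () renaming (_⊎_ to _⊎'_)

  emptyR : BRel X
  emptyR _ _ = Lift⊥
    where open import Data.Empty using () renaming (⊥ to Lift⊥)

  idR : BRel X
  idR x y = x ≡ y

  pow : BRel X → ℕ → BRel X
  pow R zero    = idR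
  pow R (suc n) = comp (pow R n) R

  star : BRel X → BRel X
  star R x y = ∃ λ n → pow R n x y

  dom : BRel X → BRel X
  dom R x x' = (x ≡ x') × (∃ λ y → R x y)

  _≐_ : BRel X → BRel X → Set
  R ≐ S = ∀ x y → (R x y → S x y) × (S x y → R x y)

record RelAlg (X : Set) : Set₂ where
  field
    Elem     : BRel X → Set₁
    comp-cl  : ∀ {R S} → Elem R → Elem S → Elem (comp R S)
    union-cl : ∀ {R S} → Elem R → Elem S → Elem (union R S)
    star-cl  : ∀ {R} → Elem R → Elem (star R)
    dom-cl   : ∀ {R} → Elem R → Elem (dom R)
    zero-in  : Elem emptyR
    one-in   : Elem idR

⟦_⟧ : {X : Set} → Term → (ℕ → BRel X) → BRel X
⟦ var n ⟧ v = v n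
⟦ s ⨾ t ⟧ v = comp (⟦ s ⟧ v) (⟦ t ⟧ v)
⟦ s ⊕ t ⟧ v = union (⟦ s ⟧ v) (⟦ t ⟧ v)
⟦ s ⋆ ⟧ v   = star (⟦ s ⟧ v)
⟦ 𝟘 ⟧ v     = emptyR
⟦ 𝟙 ⟧ v     = idR
⟦ D s ⟧ v   = dom (⟦ s ⟧ v)

Valid : Term → Term → Set₂
Valid s t = (X : Set) (A : RelAlg X) (v : ℕ → BRel X) →
            (∀ n → RelAlg.Elem A (v n)) → ⟦ s ⟧ v ≐ ⟦ t ⟧ v

-- The algebra of all relations on a set is such an algebra, so s = t is
-- valid iff the inclusions s ⊆ t and t ⊆ s hold under every valuation, and
-- each inclusion is decided through a small-model property:
--   1. Maps sending each variable's relation into the corresponding one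
--      preserve the meaning of every term.
--   2. On finite graphs with Boolean edge labels every term is decidable
--      (for ⋆, walks shorten to simple walks, which are shorter than the
--      number of nodes).
--   3. Every witness of s(x,y) in an arbitrary model is the image of a
--      witness in a finite graph (a trace, built by recursion on s).
--   4. Filtration: collapsing a finite graph by the truth values of the
--      Fischer–Ladner closure of t (relative to the target node) gives a
--      graph with at most 2^|closure| nodes from which t reflects back.
--   5. So s ⊆ t fails iff it fails in a coded graph of that size on the
--      variables of s and t; these codes form a finite, searchable set.
module Submission where

open import Defs
open import Level using (Lift; lift)
open import Function using (_∘_; id; _⇔_; mk⇔; Equivalence)
open import Data.Nat using (ℕ; zero; suc; _+_; _*_; _^_; _⊔_; _<_; _≤_; s≤s; _<?_)
open import Data.Nat.Properties using (≤-refl; ≤-trans; ≮⇒≥; m≤m⊔n; m≤n⊔m) renaming (_≟_ to _≟ℕ_)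
open import Data.Fin using (Fin; zero; suc; toℕ; fromℕ<; _↑ˡ_; _↑ʳ_; splitAt; combine; remQuot; funToFin; finToFun)
open import Data.Fin.Properties
  using (any?; _≟_; pigeonhole; <⇒≢; toℕ-fromℕ<; splitAt-↑ˡ; splitAt-↑ʳ; remQuot-combine; finToFun-funToFin)
open import Data.Fin.Subset using (Subset)
open import Data.Fin.Subset.Properties using (anySubset?)
open import Data.Product using (∃; ∃₂; _×_; _,_; proj₁; proj₂)
open import Data.Sum using (inj₁; inj₂; [_,_])
open import Data.Empty using (⊥-elim)
open import Data.Unit using (⊤; tt)
open import Data.Bool using (Bool; false; T; _∨_)
open import Data.Bool.Properties using (T-∨)
open import Data.Vec using (Vec; []; _∷_; lookup; tabulate)
open import Data.Vec.Properties using (lookup∘tabulate)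
open import Data.List using (List; []; _∷_; _++_; length)
import Data.List as List
open import Data.List.Membership.Propositional using (_∈_)
open import Data.List.Relation.Unary.Any using (here; there; index)
open import Data.List.Relation.Unary.Any.Properties using (lookup-index)
open import Data.List.Relation.Binary.Subset.Propositional using (_⊆_)
open import Data.List.Relation.Binary.Subset.Propositional.Properties using (xs⊆xs++ys; xs⊆ys++xs)
open import Relation.Binary.Definitions using (Decidable)
open import Relation.Nullary using (Dec; yes; no; ¬_)
open import Relation.Nullary.Decidable
  using (⌊_⌋; T?; toWitness; fromWitness; map′; _×-dec_; _⊎-dec_; ¬?; decidable-stable)
open import Relation.Binary.PropositionalEquality
  using (_≡_; refl; sym; trans; cong; subst; subst₂; module ≡-Reasoning)

pow-cons : ∀ {X : Set} (R : BRel X) n {x c y} → R x c → pow R n c y → pow R (suc n) x y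
pow-cons R zero    r refl        = _ , refl , r
pow-cons R (suc n) r (z , p , q) = z , pow-cons R n r p , q

pow-uncons : ∀ {X : Set} (R : BRel X) n {x y} → pow R (suc n) x y → ∃ λ c → R x c × pow R n c y
pow-uncons R zero    (_ , refl , r) = _ , r , refl
pow-uncons R (suc n) (z , p , r) with pow-uncons R n p
... | c , r′ , p′ = c , r′ , (z , p′ , r)

pow-map : ∀ {Y X : Set} {R : BRel Y} {S : BRel X} (h : Y → X) →
          (∀ {a b} → R a b → S (h a) (h b)) →
          ∀ n {a b} → pow R n a b → pow S n (h a) (h b)
pow-map h f zero    refl        = refl
pow-map h f (suc n) (z , p , r) = h z , pow-map h f n p , f r

varBound : Term → ℕ
varBound (var k) = suc k
varBound (s ⨾ t) = varBound s ⊔ varBound t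
varBound (s ⊕ t) = varBound s ⊔ varBound t
varBound (s ⋆)   = varBound s
varBound 𝟘       = 0
varBound 𝟙       = 0
varBound (D s)   = varBound s

HomBelow : {Y X : Set} → ℕ → (Y → X) → (ℕ → BRel Y) → (ℕ → BRel X) → Set
HomBelow n h u v = ∀ k → k < n → ∀ {a b} → u k a b → v k (h a) (h b)

module _ {Y X : Set} {u : ℕ → BRel Y} {v : ℕ → BRel X} (h : Y → X) where

  homBelow-weaken : ∀ {m n} → m ≤ n → HomBelow n h u v → HomBelow m h u v
  homBelow-weaken m≤n H k k<m = H k (≤-trans k<m m≤n)

  preserve : ∀ t → HomBelow (varBound t) h u v → ∀ {a b} → ⟦ t ⟧ u a b → ⟦ t ⟧ v (h a) (h b)
  preserve (var k) H w              = H k ≤-refl w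
  preserve (s ⨾ t) H (z , p , q)    =
    h z , preserve s (homBelow-weaken (m≤m⊔n _ _) H) p , preserve t (homBelow-weaken (m≤n⊔m _ _) H) q
  preserve (s ⊕ t) H (inj₁ p)       = inj₁ (preserve s (homBelow-weaken (m≤m⊔n _ _) H) p)
  preserve (s ⊕ t) H (inj₂ q)       = inj₂ (preserve t (homBelow-weaken (m≤n⊔m _ _) H) q)
  preserve (s ⋆)   H (n , p)        = n , pow-map h (preserve s H) n p
  preserve 𝟙       H refl           = refl
  preserve (D s)   H (refl , y , p) = refl , h y , preserve s H p

agree : ∀ t {n} {Y : Set} {u v : ℕ → BRel Y} → varBound t ≤ n →
        (∀ k → k < n → ∀ {a b} → u k a b → v k a b) → ∀ {a b} → ⟦ t ⟧ u a b → ⟦ t ⟧ v a b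
agree t {u = u} {v} t≤n H = preserve id t (homBelow-weaken {u = u} {v} id t≤n H)

-- A finite graph on m nodes whose edges carry variable labels.
Graph : ℕ → Set
Graph m = ℕ → Fin m → Fin m → Bool

edges : ∀ {m} → Graph m → ℕ → BRel (Fin m)
edges E k i j = T (E k i j)

GraphHom : ∀ {m n} → (Fin m → Fin n) → Graph m → Graph n → Set
GraphHom g E E′ = ∀ k i j → T (E k i j) → T (E′ k (g i) (g j))

image : ∀ {m n} → (Fin m → Fin n) → Graph m → Graph n
image g E k a b = ⌊ any? (λ i → any? (λ j → (g i ≟ a) ×-dec (g j ≟ b) ×-dec T? (E k i j))) ⌋

image-hom : ∀ {m n} (g : Fin m → Fin n) (E : Graph m) → GraphHom g E (image g E)
image-hom g E k i j e = fromWitness (i , j , refl , refl , e)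

image-edge : ∀ {m n} (g : Fin m → Fin n) (E : Graph m) k a b → T (image g E k a b) →
             ∃₂ λ i j → g i ≡ a × g j ≡ b × T (E k i j)
image-edge g E k a b e = toWitness e

-- A walk of n steps along R from i to j that visits no node twice.  Steps
-- are added at the end, as in pow; `nodes` lists the visited nodes.
module SimpleWalks {m : ℕ} (R : BRel (Fin m)) where

  mutual
    data Walk (i : Fin m) : Fin m → ℕ → Set where
      stay : Walk i i 0
      snoc : ∀ {k j n} (w : Walk i k n) → R k j → ¬ Visits w j → Walk i j (suc n)

    nodes : ∀ {i j n} → Walk i j n → Vec (Fin m) (suc n)
    nodes {i} stay            = i ∷ []
    nodes {j = j} (snoc w _ _) = j ∷ nodes w

    Visits : ∀ {i k n} → Walk i k n → Fin m → Set
    Visits w x = ∃ λ p → lookup (nodes w) p ≡ x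

  visits? : ∀ {i k n} (w : Walk i k n) x → Dec (Visits w x)
  visits? w x = any? (λ p → lookup (nodes w) p ≟ x)

  prefix : ∀ {i k n x} (w : Walk i k n) → Visits w x → ∃ λ n′ → Walk i x n′
  prefix stay            (zero , refl)  = _ , stay
  prefix (snoc w r new)  (zero , refl)  = _ , snoc w r new
  prefix (snoc w _ _)    (suc p , eq)   = prefix w (p , eq)

  simplify : ∀ n {i j} → pow R n i j → ∃ λ n′ → Walk i j n′
  simplify zero    refl                 = _ , stay
  simplify (suc n) {j = j} (k , p , r) with simplify n p
  ... | _ , w with visits? w j
  ...   | yes seen = prefix w seen
  ...   | no new   = _ , snoc w r new

  toPow : ∀ {i j n} → Walk i j n → pow R n i j
  toPow stay         = refl
  toPow (snoc w r _) = _ , toPow w , r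

  nodes-injective : ∀ {i j n} (w : Walk i j n) a b → lookup (nodes w) a ≡ lookup (nodes w) b → a ≡ b
  nodes-injective stay           zero    zero    _  = refl
  nodes-injective (snoc w _ _)   zero    zero    _  = refl
  nodes-injective (snoc w _ new) zero    (suc b) eq = ⊥-elim (new (b , sym eq))
  nodes-injective (snoc w _ new) (suc a) zero    eq = ⊥-elim (new (a , eq))
  nodes-injective (snoc w _ _)   (suc a) (suc b) eq = cong suc (nodes-injective w a b eq)

  -- A simple walk visits n+1 distinct nodes, so n < m by pigeonhole.
  walk-short : ∀ {i j n} → Walk i j n → n < m
  walk-short {n = n} w with n <? m
  ... | yes n<m = n<m
  ... | no n≮m with pigeonhole (s≤s (≮⇒≥ n≮m)) (lookup (nodes w))
  ...   | a , b , a<b , eq = ⊥-elim (<⇒≢ a<b (nodes-injective w a b eq))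

  shorten : ∀ n {i j} → pow R n i j → ∃ λ n′ → n′ < m × pow R n′ i j
  shorten n p with simplify n p
  ... | n′ , w = n′ , walk-short w , toPow w

decComp : ∀ {m} {R S : BRel (Fin m)} → Decidable R → Decidable S → Decidable (comp R S)
decComp R? S? i j = any? (λ z → R? i z ×-dec S? z j)

decPow : ∀ {m} {R : BRel (Fin m)} → Decidable R → ∀ n → Decidable (pow R n)
decPow R? zero    = _≟_
decPow R? (suc n) = decComp (decPow R? n) R?

-- R* on m nodes is the union of the powers below m.
decStar : ∀ {m} {R : BRel (Fin m)} → Decidable R → Decidable (star R)
decStar {m} {R} R? i j = map′ fromBounded toBounded (any? (λ (n : Fin m) → decPow R? (toℕ n) i j))
  where
  fromBounded : (∃ λ (n : Fin m) → pow R (toℕ n) i j) → star R i j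
  fromBounded (n , p) = toℕ n , p
  toBounded : star R i j → ∃ λ (n : Fin m) → pow R (toℕ n) i j
  toBounded (n , p) with SimpleWalks.shorten R n p
  ... | n′ , n′<m , p′ = fromℕ< n′<m , subst (λ l → pow R l i j) (sym (toℕ-fromℕ< n′<m)) p′

decide : ∀ t {m} (E : Graph m) → Decidable (⟦ t ⟧ (edges E))
decide (var k) E i j = T? (E k i j)
decide (s ⨾ t) E     = decComp (decide s E) (decide t E)
decide (s ⊕ t) E i j = decide s E i j ⊎-dec decide t E i j
decide (s ⋆)   E     = decStar (decide s E)
decide 𝟘       E i j = no λ ()
decide 𝟙       E     = _≟_
decide (D s)   E i j = (i ≟ j) ×-dec any? (decide s E i)

GraphProp : Set₁
GraphProp = ∀ {m} → Graph m → BRel (Fin m)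

Stable : GraphProp → Set
Stable P = ∀ {m n} (g : Fin m → Fin n) {E E′} → GraphHom g E E′ → ∀ {a b} → P E a b → P E′ (g a) (g b)

term-stable : ∀ t → Stable (λ E → ⟦ t ⟧ (edges E))
term-stable t g H = preserve g t (λ k _ → H k _ _)

pow-stable : ∀ {P : GraphProp} → Stable P → ∀ n → Stable (λ E → pow (P E) n)
pow-stable P-stable n g H = pow-map g (P-stable g H) n

module Traces {X : Set} (v : ℕ → BRel X) where

  HomInto : ∀ {m} → Graph m → (Fin m → X) → Set
  HomInto E e = ∀ k i j → T (E k i j) → v k (e i) (e j)

  image-into : ∀ {m n} (g : Fin m → Fin n) {E : Graph m} {e : Fin m → X} {e′ : Fin n → X} →
               (∀ i → e′ (g i) ≡ e i) → HomInto E e → HomInto (image g E) e′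
  image-into g {E} e′∘g H k a b edge with image-edge g E k a b edge
  ... | i , j , refl , refl , e = subst₂ (v k) (sym (e′∘g i)) (sym (e′∘g j)) (H k i j e)

  record Trace : Set where
    constructor trace
    field
      size  : ℕ
      graph : Graph size
      embed : Fin size → X
      hom   : HomInto graph embed
  open Trace

  record Traced (P : GraphProp) (x y : X) : Set where
    constructor traced
    field
      base         : Trace
      source target : Fin (size base)
      source-over  : embed base source ≡ x
      target-over  : embed base target ≡ y
      witness      : P (graph base) source target

  -- Two traces glued by identifying node b₁ of the first with node a₂ of the
  -- second, which lie over the same point.  The nodes are Fin (m₁ + m₂); the
  -- copy of a₂ in the right summand is left isolated.
  module Glue (T₁ T₂ : Trace) (b₁ : Fin (size T₁)) (a₂ : Fin (size T₂))
              (same : embed T₁ b₁ ≡ embed T₂ a₂) where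
    m₁ m₂ : ℕ
    m₁ = size T₁
    m₂ = size T₂

    ι₁ : Fin m₁ → Fin (m₁ + m₂)
    ι₁ i = i ↑ˡ m₂

    ι₂ : Fin m₂ → Fin (m₁ + m₂)
    ι₂ j with j ≟ a₂
    ... | yes _ = ι₁ b₁
    ... | no _  = m₁ ↑ʳ j

    ι₂-joins : ι₂ a₂ ≡ ι₁ b₁
    ι₂-joins with a₂ ≟ a₂
    ... | yes _   = refl
    ... | no a₂≢a₂ = ⊥-elim (a₂≢a₂ refl)

    glued-embed : Fin (m₁ + m₂) → X
    glued-embed = [ embed T₁ , embed T₂ ] ∘ splitAt m₁

    embed-ι₁ : ∀ i → glued-embed (ι₁ i) ≡ embed T₁ i
    embed-ι₁ i = cong [ embed T₁ , embed T₂ ] (splitAt-↑ˡ m₁ i m₂)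

    embed-ι₂ : ∀ j → glued-embed (ι₂ j) ≡ embed T₂ j
    embed-ι₂ j with j ≟ a₂
    ... | yes refl = trans (embed-ι₁ b₁) same
    ... | no _     = cong [ embed T₁ , embed T₂ ] (splitAt-↑ʳ m₁ m₂ j)

    glued-graph : Graph (m₁ + m₂)
    glued-graph k a b = image ι₁ (graph T₁) k a b ∨ image ι₂ (graph T₂) k a b

    glued : Trace
    glued = trace (m₁ + m₂) glued-graph glued-embed glued-hom
      where
      glued-hom : HomInto glued-graph glued-embed
      glued-hom k a b e with Equivalence.to T-∨ e
      ... | inj₁ e₁ = image-into ι₁ embed-ι₁ (hom T₁) k a b e₁
      ... | inj₂ e₂ = image-into ι₂ embed-ι₂ (hom T₂) k a b e₂

    ι₁-hom : GraphHom ι₁ (graph T₁) glued-graph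
    ι₁-hom k i j e = Equivalence.from T-∨ (inj₁ (image-hom ι₁ (graph T₁) k i j e))

    ι₂-hom : GraphHom ι₂ (graph T₂) glued-graph
    ι₂-hom k i j e = Equivalence.from T-∨ (inj₂ (image-hom ι₂ (graph T₂) k i j e))

  traceComp : ∀ {P Q : GraphProp} {x y z} → Stable P → Stable Q → Traced P x y → Traced Q y z →
              Traced (λ E → comp (P E) (Q E)) x z
  traceComp {Q = Q} P-stable Q-stable (traced T₁ a₁ b₁ a₁-over b₁-over p) (traced T₂ a₂ b₂ a₂-over b₂-over q) =
    traced glued (ι₁ a₁) (ι₂ b₂) (trans (embed-ι₁ a₁) a₁-over) (trans (embed-ι₂ b₂) b₂-over)
      (ι₁ b₁ , P-stable ι₁ ι₁-hom p , subst (λ c → Q glued-graph c (ι₂ b₂)) ι₂-joins (Q-stable ι₂ ι₂-hom q))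
    where open Glue T₁ T₂ b₁ a₂ (trans b₁-over (sym a₂-over))

  traceMap : ∀ {P Q : GraphProp} {x y} → (∀ {m} {E : Graph m} {a b} → P E a b → Q E a b) →
             Traced P x y → Traced Q x y
  traceMap f (traced T a b a-over b-over p) = traced T a b a-over b-over (f p)

  traceRefl : ∀ x → Traced (λ _ → idR) x x
  traceRefl x = traced (trace 1 (λ _ _ _ → false) (λ _ → x) (λ _ _ _ ())) zero zero refl refl refl

  traceEdge : ∀ k {x y} → v k x y → Traced (λ E → edges E k) x y
  traceEdge k {x} {y} r = traced (trace 2 edge ends edge-hom) zero (suc zero) refl refl (fromWitness refl)
    where
    edge : Graph 2
    edge k′ zero (suc zero) = ⌊ k′ ≟ℕ k ⌋
    edge _  _    _          = false
    ends : Fin 2 → X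
    ends zero    = x
    ends (suc _) = y
    edge-hom : HomInto edge ends
    edge-hom k′ zero (suc zero) e with toWitness e
    ... | refl = r

  tracePow : ∀ {P : GraphProp} {R : BRel X} → Stable P → (∀ {x y} → R x y → Traced P x y) →
             ∀ n {x y} → pow R n x y → Traced (λ E → pow (P E) n) x y
  tracePow P-stable traceR zero    refl        = traceRefl _
  tracePow P-stable traceR (suc n) (z , p , r) =
    traceComp (pow-stable P-stable n) P-stable (tracePow P-stable traceR n p) (traceR r)

  traceTerm : ∀ t {x y} → ⟦ t ⟧ v x y → Traced (λ E → ⟦ t ⟧ (edges E)) x y
  traceTerm (var k) r              = traceEdge k r
  traceTerm (s ⨾ t) (z , p , q)    = traceComp (term-stable s) (term-stable t) (traceTerm s p) (traceTerm t q)
  traceTerm (s ⊕ t) (inj₁ p)       = traceMap inj₁ (traceTerm s p)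
  traceTerm (s ⊕ t) (inj₂ q)       = traceMap inj₂ (traceTerm t q)
  traceTerm (s ⋆)   (n , p)        = traceMap (n ,_) (tracePow (term-stable s) (traceTerm s) n p)
  traceTerm 𝟙       refl           = traceRefl _
  traceTerm (D s)   (refl , y , p) with traceTerm s p
  ... | traced T a b a-over _ w = traced T a a a-over a-over (refl , b , w)

-- Formulas of the diamond fragment: ⊤, the target nominal, ⟨α⟩φ.
data Formula : Set where
  top     : Formula
  nominal : Formula
  ⟨_⟩_    : Term → Formula → Formula

-- The formulas whose truth values a filtration must respect so that
-- ⟨α⟩ψ reflects (its Fischer–Ladner closure, down to the variables).
closure : Term → Formula → List Formula
closure (var k) ψ = (⟨ var k ⟩ ψ) ∷ []
closure (s ⨾ t) ψ = closure s (⟨ t ⟩ ψ) ++ closure t ψ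
closure (s ⊕ t) ψ = closure s ψ ++ closure t ψ
closure (s ⋆)   ψ = closure s (⟨ s ⋆ ⟩ ψ)
closure 𝟘       ψ = []
closure 𝟙       ψ = []
closure (D s)   ψ = closure s top

truth : {P : Set} → Dec P → Fin 2
truth (yes _) = suc zero
truth (no _)  = zero

truth-transfer : {P Q : Set} (p : Dec P) (q : Dec Q) → truth p ≡ truth q → P → Q
truth-transfer (yes _) (yes q) _  _ = q
truth-transfer (no ¬p) _       _  p = ⊥-elim (¬p p)

module Filtration {m : ℕ} (E : Graph m) (y : Fin m) (Σs : List Formula) where

  holds : Formula → Fin m → Set
  holds top         z = ⊤
  holds nominal     z = z ≡ y
  holds (⟨ α ⟩ φ)   z = ∃ λ w → ⟦ α ⟧ (edges E) z w × holds φ w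

  holds? : ∀ φ z → Dec (holds φ z)
  holds? top       z = yes tt
  holds? nominal   z = z ≟ y
  holds? (⟨ α ⟩ φ) z = any? (λ w → decide α E z w ×-dec holds? φ w)

  profile : Fin m → Fin (length Σs) → Fin 2
  profile z i = truth (holds? (List.lookup Σs i) z)

  classes : ℕ
  classes = 2 ^ length Σs

  collapse : Fin m → Fin classes
  collapse z = funToFin (profile z)

  collapsed : Graph classes
  collapsed = image collapse E

  transfer : ∀ {φ z w} → φ ∈ Σs → collapse z ≡ collapse w → holds φ z → holds φ w
  transfer {φ} {z} {w} φ∈Σs same =
    subst (λ ψ → holds ψ z → holds ψ w) (sym (lookup-index φ∈Σs))
      (truth-transfer (holds? _ z) (holds? _ w) same-profile)
    where
    i : Fin (length Σs)
    i = index φ∈Σs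
    same-profile : profile z i ≡ profile w i
    same-profile = begin
      profile z i                          ≡⟨ finToFun-funToFin (profile z) i ⟨
      finToFun (collapse z) i              ≡⟨ cong (λ c → finToFun c i) same ⟩
      finToFun (collapse w) i              ≡⟨ finToFun-funToFin (profile w) i ⟩
      profile w i                          ∎
      where open ≡-Reasoning

  mutual
    lift-⟨⟩ : ∀ α ψ → closure α ψ ⊆ Σs → ∀ z {c} → ⟦ α ⟧ (edges collapsed) (collapse z) c →
              (∀ w → collapse w ≡ c → holds ψ w) → holds (⟨ α ⟩ ψ) z
    lift-⟨⟩ (var k) ψ ⊆Σ z e hyp with image-edge collapse E k _ _ e
    ... | z′ , w , z′~z , refl , e′ = transfer (⊆Σ (here refl)) z′~z (w , e′ , hyp w refl)
    lift-⟨⟩ (s ⨾ t) ψ ⊆Σ z (c , p , q) hyp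
      with lift-⟨⟩ s (⟨ t ⟩ ψ) (⊆Σ ∘ xs⊆xs++ys _ _) z p
             (λ u u~c → lift-⟨⟩ t ψ (⊆Σ ∘ xs⊆ys++xs _ _) u (subst (λ d → ⟦ t ⟧ _ d _) (sym u~c) q) hyp)
    ... | w₁ , p′ , w , q′ , ψw = w , (w₁ , p′ , q′) , ψw
    lift-⟨⟩ (s ⊕ t) ψ ⊆Σ z (inj₁ p) hyp with lift-⟨⟩ s ψ (⊆Σ ∘ xs⊆xs++ys _ _) z p hyp
    ... | w , p′ , ψw = w , inj₁ p′ , ψw
    lift-⟨⟩ (s ⊕ t) ψ ⊆Σ z (inj₂ q) hyp with lift-⟨⟩ t ψ (⊆Σ ∘ xs⊆ys++xs _ _) z q hyp
    ... | w , q′ , ψw = w , inj₂ q′ , ψw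
    lift-⟨⟩ (s ⋆)   ψ ⊆Σ z (n , p) hyp = lift-⟨⋆⟩ s ψ ⊆Σ n z p hyp
    lift-⟨⟩ 𝟙       ψ ⊆Σ z refl hyp    = z , refl , hyp z refl
    lift-⟨⟩ (D s)   ψ ⊆Σ z (refl , c , p) hyp with lift-⟨⟩ s top ⊆Σ z p (λ _ _ → tt)
    ... | w , p′ , _ = z , (refl , w , p′) , hyp z refl

    lift-⟨⋆⟩ : ∀ α ψ → closure α (⟨ α ⋆ ⟩ ψ) ⊆ Σs → ∀ n z {c} →
               pow (⟦ α ⟧ (edges collapsed)) n (collapse z) c →
               (∀ w → collapse w ≡ c → holds ψ w) → holds (⟨ α ⋆ ⟩ ψ) z
    lift-⟨⋆⟩ α ψ ⊆Σ zero    z refl hyp = z , (0 , refl) , hyp z refl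
    lift-⟨⋆⟩ α ψ ⊆Σ (suc n) z p    hyp with pow-uncons _ n p
    ... | d , r , p′ with lift-⟨⟩ α (⟨ α ⋆ ⟩ ψ) ⊆Σ z r
                            (λ u u~d → lift-⟨⋆⟩ α ψ ⊆Σ n u (subst (λ e → pow _ n e _) (sym u~d) p′) hyp)
    ... | w , r′ , w′ , (k , p″) , ψw′ = w′ , (suc k , pow-cons _ k r′ p″) , ψw′

  reflect : ∀ t x → nominal ∈ Σs → closure t nominal ⊆ Σs →
            ⟦ t ⟧ (edges collapsed) (collapse x) (collapse y) → ⟦ t ⟧ (edges E) x y
  reflect t x nominal∈Σs ⊆Σ w
    with lift-⟨⟩ t nominal ⊆Σ x w (λ u u~y → transfer nominal∈Σs (sym u~y) refl)
  ... | _ , w′ , refl = w′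

-- Graphs on N nodes interpreting the variables below V, coded as subsets
-- of Fin V × Fin N × Fin N; the codes form a finite searchable set.
Code : ℕ → ℕ → Set
Code V N = Subset (V * (N * N))

decode : ∀ V N → Code V N → Graph N
decode V N c k i j with k <? V
... | yes k<V = lookup c (combine (fromℕ< k<V) (combine i j))
... | no _    = false

edgeBit : ∀ V {N} → Graph N → Fin (V * (N * N)) → Bool
edgeBit V {N} E c = E (toℕ (proj₁ k,ij)) (proj₁ i,j) (proj₂ i,j)
  where
  k,ij : Fin V × Fin (N * N)
  k,ij = remQuot {V} (N * N) c
  i,j : Fin N × Fin N
  i,j = remQuot {N} N (proj₂ k,ij)

encode : ∀ V {N} → Graph N → Code V N
encode V E = tabulate (edgeBit V E)

edgeBit-combine : ∀ V {N} (E : Graph N) k i j → edgeBit V E (combine k (combine i j)) ≡ E (toℕ k) i j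
edgeBit-combine V {N} E k i j = begin
  edgeBit V E (combine k (combine i j))
    ≡⟨ cong (λ (k′ , ij) → E (toℕ k′) (proj₁ (remQuot {N} N ij)) (proj₂ (remQuot {N} N ij)))
            (remQuot-combine k (combine i j)) ⟩
  E (toℕ k) (proj₁ (remQuot {N} N (combine i j))) (proj₂ (remQuot {N} N (combine i j)))
    ≡⟨ cong (λ (i′ , j′) → E (toℕ k) i′ j′) (remQuot-combine i j) ⟩
  E (toℕ k) i j ∎
  where open ≡-Reasoning

decode-encode : ∀ {V N} (E : Graph N) k → k < V → ∀ i j → decode V N (encode V E) k i j ≡ E k i j
decode-encode {V} E k k<V i j with k <? V
... | no k≮V = ⊥-elim (k≮V k<V)
... | yes k<V′ = begin
  lookup (encode V E) (combine (fromℕ< k<V′) (combine i j)) ≡⟨ lookup∘tabulate (edgeBit V E) _ ⟩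
  edgeBit V E (combine (fromℕ< k<V′) (combine i j))         ≡⟨ edgeBit-combine V E (fromℕ< k<V′) i j ⟩
  E (toℕ (fromℕ< k<V′)) i j                                 ≡⟨ cong (λ k′ → E k′ i j) (toℕ-fromℕ< k<V′) ⟩
  E k i j                                                   ∎
  where open ≡-Reasoning

varsOf : Term → Term → ℕ
varsOf s t = varBound s ⊔ varBound t

targetFormulas : Term → List Formula
targetFormulas t = nominal ∷ closure t nominal

modelSize : Term → ℕ
modelSize t = 2 ^ length (targetFormulas t)

smallGraph : ∀ s t → Code (varsOf s t) (modelSize t) → Graph (modelSize t)
smallGraph s t = decode (varsOf s t) (modelSize t)

Counterexample : Term → Term → Set
Counterexample s t =
  ∃ λ (c : Code (varsOf s t) (modelSize t)) → ∃₂ λ i j →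
    ⟦ s ⟧ (edges (smallGraph s t c)) i j × ¬ ⟦ t ⟧ (edges (smallGraph s t c)) i j

counterexample? : ∀ s t → Dec (Counterexample s t)
counterexample? s t =
  anySubset? λ c → any? λ i → any? λ j → decide s (smallGraph s t c) i j ×-dec ¬? (decide t (smallGraph s t c) i j)

smallModel : ∀ s t {X : Set} (v : ℕ → BRel X) {x y} → ⟦ s ⟧ v x y →
             ∃ λ (c : Code (varsOf s t) (modelSize t)) → ∃₂ λ i j →
               ⟦ s ⟧ (edges (smallGraph s t c)) i j × (⟦ t ⟧ (edges (smallGraph s t c)) i j → ⟦ t ⟧ v x y)
smallModel s t v w with Traces.traceTerm v s w
... | Traces.traced (Traces.trace _ G e e-hom) a b refl refl ws =
  encode V collapsed , collapse a , collapse b , s-small , t-back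
  where
  open Filtration G b (targetFormulas t)
  V : ℕ
  V = varsOf s t
  small : Graph (modelSize t)
  small = smallGraph s t (encode V collapsed)

  -- s survives collapsing (a homomorphism) and coding (exact on its variables).
  s-small : ⟦ s ⟧ (edges small) (collapse a) (collapse b)
  s-small = agree s (m≤m⊔n _ _) (λ k k<V → subst T (sym (decode-encode {V} collapsed k k<V _ _)))
              (term-stable s collapse (image-hom collapse G) ws)

  -- t goes back through decoding, then by reflection to G, then along e.
  t-back : ⟦ t ⟧ (edges small) (collapse a) (collapse b) → ⟦ t ⟧ v (e a) (e b)
  t-back wt = preserve e t (λ k _ → e-hom k _ _)
                (reflect t a (here refl) there
                  (agree t (m≤n⊔m _ _) (λ k k<V → subst T (decode-encode {V} collapsed k k<V _ _)) wt))

Included : Term → Term → Set₁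
Included s t = ∀ {X : Set} (v : ℕ → BRel X) x y → ⟦ s ⟧ v x y → ⟦ t ⟧ v x y

decIncluded : ∀ s t → Dec (Included s t)
decIncluded s t with counterexample? s t
... | yes (c , i , j , ws , ¬wt) = no λ s⊆t → ¬wt (s⊆t (edges (smallGraph s t c)) i j ws)
... | no none = yes λ v x y ws →
  let (c , i , j , ws′ , back) = smallModel s t v ws
  in back (decidable-stable (decide t (smallGraph s t c) i j) λ ¬wt → none (c , i , j , ws′ , ¬wt))

fullAlgebra : (X : Set) → RelAlg X
fullAlgebra X = record
  { Elem = λ _ → Lift _ ⊤ ; comp-cl = λ _ _ → lift tt ; union-cl = λ _ _ → lift tt
  ; star-cl = λ _ → lift tt ; dom-cl = λ _ → lift tt ; zero-in = lift tt ; one-in = lift tt }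

-- Validity is mutual inclusion; the full algebras suffice to refute it.
valid⇔included : ∀ s t → Valid s t ⇔ (Included s t × Included t s)
valid⇔included s t = mk⇔
  (λ valid → (λ {X} v x y → proj₁ (valid X (fullAlgebra X) v (λ _ → lift tt) x y))
           , (λ {X} v x y → proj₂ (valid X (fullAlgebra X) v (λ _ → lift tt) x y)))
  (λ (s⊆t , t⊆s) X _ v _ x y → s⊆t v x y , t⊆s v x y)

theorem7p2 : (s t : Term) → Dec (Valid s t)
theorem7p2 s t = map′ (Equivalence.from (valid⇔included s t)) (Equivalence.to (valid⇔included s t))
                      (decIncluded s t ×-dec decIncluded t s)
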